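{- Let $L$ be a Latin square and let $C_1,\dots,C_m$ be pairwise disjoint defining sets of $L$. Then $C_1\cup C_2\cup\dots\cup C_m$ is an $m$-strong defining set of $L$.
   Context: A partial Latin square (PLS) is an array in which some cells may be empty and each symbol occurs at most once per row and column; arrays are identified with sets of triples (row, column; symbol). A Latin trade in $L$ is a non-empty PLS $T\subseteq L$ for which there is a PLS $T'$ of the same order with $T\cap T'=\emptyset$, the same set of non-empty cells as $T$, and the same set of symbols as $T$ in each row and in each column. A defining set of $L$ is a subset of $L$ contained in no other Latin square of the same order. A defining set $D$ of $L$ is $k$-strong if $|D\cap T|\geq k$ for every Latin trade $T\subseteq L$. -}

module Defs where

open import Data.Nat using (ℕ; zero; suc; _+_; _≤_)
open import Data.Fin using (Fin; zero; suc)
open import Data.Bool using (Bool; true; false; _∧_; _∨_; if_then_else_)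
open import Data.Product using (Σ; ∃; _×_; _,_)
open import Relation.Binary.PropositionalEquality using (_≡_)
open import Relation.Nullary using (¬_)
open import Function.Bundles using (_⇔_)

-- A (partial) array of order n, identified with its set of triples
-- (row, column; symbol), given by a decidable membership predicate.
Array : ℕ → Set
Array n = Fin n → Fin n → Fin n → Bool

_∋⟨_,_,_⟩ : ∀ {n} → Array n → Fin n → Fin n → Fin n → Set
P ∋⟨ r , c , s ⟩ = P r c s ≡ true

record IsPLS {n : ℕ} (P : Array n) : Set where
  field
    cell : ∀ r c s s' → P ∋⟨ r , c , s ⟩ → P ∋⟨ r , c , s' ⟩ → s ≡ s'
    row  : ∀ r c c' s → P ∋⟨ r , c , s ⟩ → P ∋⟨ r , c' , s ⟩ → c ≡ c'
    col  : ∀ r r' c s → P ∋⟨ r , c , s ⟩ → P ∋⟨ r' , c , s ⟩ → r ≡ r'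

record IsLatinSquare {n : ℕ} (L : Array n) : Set where
  field
    pls    : IsPLS L
    filled : ∀ r c → ∃ λ s → L ∋⟨ r , c , s ⟩

_⊆_ : ∀ {n} → Array n → Array n → Set
P ⊆ Q = ∀ r c s → P ∋⟨ r , c , s ⟩ → Q ∋⟨ r , c , s ⟩

Disjoint : ∀ {n} → Array n → Array n → Set
Disjoint P Q = ∀ r c s → P ∋⟨ r , c , s ⟩ → Q ∋⟨ r , c , s ⟩ → Data.Empty.⊥
  where import Data.Empty

record IsLatinTrade {n : ℕ} (L T : Array n) : Set where
  field
    pls       : IsPLS T
    nonEmpty  : ∃ λ r → ∃ λ c → ∃ λ s → T ∋⟨ r , c , s ⟩
    sub       : T ⊆ L
    partner   : Array n
    partnerPLS   : IsPLS partner
    disjoint     : Disjoint T partner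
    sameCells    : ∀ r c → (∃ λ s → T ∋⟨ r , c , s ⟩) ⇔ (∃ λ s → partner ∋⟨ r , c , s ⟩)
    sameRowSyms  : ∀ r s → (∃ λ c → T ∋⟨ r , c , s ⟩) ⇔ (∃ λ c → partner ∋⟨ r , c , s ⟩)
    sameColSyms  : ∀ c s → (∃ λ r → T ∋⟨ r , c , s ⟩) ⇔ (∃ λ r → partner ∋⟨ r , c , s ⟩)

record IsDefiningSet {n : ℕ} (L D : Array n) : Set where
  field
    sub    : D ⊆ L
    unique : (L' : Array n) → IsLatinSquare L' → D ⊆ L' →
             ∀ r c s → L' ∋⟨ r , c , s ⟩ → L ∋⟨ r , c , s ⟩

sumFin : ∀ {k} → (Fin k → ℕ) → ℕ
sumFin {zero}  f = 0
sumFin {suc k} f = f zero + sumFin (λ i → f (suc i))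

anyFin : ∀ {k} → (Fin k → Bool) → Bool
anyFin {zero}  f = false
anyFin {suc k} f = f zero ∨ anyFin (λ i → f (suc i))

∣_∩_∣ : ∀ {n} → Array n → Array n → ℕ
∣ P ∩ Q ∣ = sumFin λ r → sumFin λ c → sumFin λ s →
              if P r c s ∧ Q r c s then 1 else 0

⋃ : ∀ {n m} → (Fin m → Array n) → Array n
⋃ C r c s = anyFin λ i → C i r c s

record IsStrongDefiningSet (k : ℕ) {n : ℕ} (L D : Array n) : Set where
  field
    defining : IsDefiningSet L D
    strong   : (T : Array n) → IsLatinTrade L T → k ≤ ∣ D ∩ T ∣

-- If T′ is the mate of a Latin trade T ⊆ L, then (L ∖ T) ∪ T′ is again a
-- Latin square, and it differs from L on every cell of T. A defining set of L
-- avoiding T would lie inside it and force it to be L; so every defining set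
-- meets every trade. Pairwise disjoint defining sets C₁, …, Cₘ thus put m
-- distinct triples into (⋃ Cᵢ) ∩ T, and the union is defining because it
-- already contains the defining set C₁.
module Submission where

open import Defs
open import Data.Nat using (ℕ; zero; suc; _+_; _≤_; _<_; z≤n)
open import Data.Nat.Properties
  using (+-0-commutativeMonoid; +-mono-≤; +-identityʳ; ≤-reflexive; m+n≡0⇒m≡0; m+n≡0⇒n≡0; n≢0⇒n>0; module ≤-Reasoning)
open import Algebra.Properties.CommutativeMonoid.Sum +-0-commutativeMonoid using (sum; sum-cong-≗; ∑-comm)
open import Data.Fin using (Fin; zero; suc)
open import Data.Fin.Properties using (suc-injective)
open import Data.Bool using (Bool; true; false; _∧_; _∨_; not; if_then_else_)
open import Data.Bool.Properties using (∨-zeroʳ; ¬-not; not-¬)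
open import Data.Product using (∃; _×_; _,_; proj₁)
open import Data.Sum using (_⊎_; inj₁; inj₂)
open import Data.Empty using (⊥; ⊥-elim)
open import Function using (_∘_; flip; Equivalence)
open import Relation.Nullary using (¬_)
open import Relation.Binary.PropositionalEquality
  using (_≡_; _≢_; refl; sym; trans; cong; cong₂; subst; module ≡-Reasoning)

∧-true⁻ : ∀ {a b} → a ∧ b ≡ true → a ≡ true × b ≡ true
∧-true⁻ {true} {true} _ = refl , refl

∨-true⁻ : ∀ {a b} → a ∨ b ≡ true → a ≡ true ⊎ b ≡ true
∨-true⁻ {true}  _ = inj₁ refl
∨-true⁻ {false} p = inj₂ p

not-true⁻ : ∀ {a} → not a ≡ true → a ≢ true
not-true⁻ {false} _ ()

indicator : Bool → ℕ
indicator b = if b then 1 else 0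

sumFin≡sum : ∀ {k} (f : Fin k → ℕ) → sumFin f ≡ sum f
sumFin≡sum {zero}  f = refl
sumFin≡sum {suc k} f = cong (f zero +_) (sumFin≡sum (f ∘ suc))

sumFin-cong : ∀ {k} {f g : Fin k → ℕ} → (∀ i → f i ≡ g i) → sumFin f ≡ sumFin g
sumFin-cong {f = f} {g} f≗g = trans (sumFin≡sum f) (trans (sum-cong-≗ f≗g) (sym (sumFin≡sum g)))

sumFin-comm : ∀ {k l} (f : Fin k → Fin l → ℕ) →
              sumFin (λ i → sumFin (f i)) ≡ sumFin (λ j → sumFin (λ i → f i j))
sumFin-comm f = begin
  sumFin (λ i → sumFin (f i))          ≡⟨ sumFin²≡sum² f ⟩
  sum (λ i → sum (f i))                ≡⟨ ∑-comm f ⟩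
  sum (λ j → sum (λ i → f i j))        ≡⟨ sumFin²≡sum² (flip f) ⟨
  sumFin (λ j → sumFin (λ i → f i j))  ∎
  where
  open ≡-Reasoning
  sumFin²≡sum² : ∀ {k l} (g : Fin k → Fin l → ℕ) → sumFin (λ i → sumFin (g i)) ≡ sum (λ i → sum (g i))
  sumFin²≡sum² g = trans (sumFin≡sum (λ i → sumFin (g i))) (sum-cong-≗ (sumFin≡sum ∘ g))

sumFin-mono-≤ : ∀ {k} {f g : Fin k → ℕ} → (∀ i → f i ≤ g i) → sumFin f ≤ sumFin g
sumFin-mono-≤ {zero}  f≤g = z≤n
sumFin-mono-≤ {suc k} f≤g = +-mono-≤ (f≤g zero) (sumFin-mono-≤ (f≤g ∘ suc))

sumFin-zero : ∀ {k} {f : Fin k → ℕ} → (∀ i → f i ≡ 0) → sumFin f ≡ 0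
sumFin-zero {zero}  f≗0 = refl
sumFin-zero {suc k} f≗0 = cong₂ _+_ (f≗0 zero) (sumFin-zero (f≗0 ∘ suc))

sumFin≡0⇒≡0 : ∀ {k} {f : Fin k → ℕ} → sumFin f ≡ 0 → ∀ i → f i ≡ 0
sumFin≡0⇒≡0 {f = f} Σf≡0 zero    = m+n≡0⇒m≡0 (f zero) Σf≡0
sumFin≡0⇒≡0 {f = f} Σf≡0 (suc i) = sumFin≡0⇒≡0 (m+n≡0⇒n≡0 (f zero) Σf≡0) i

k≤sumFin-positive : ∀ {k} {f : Fin k → ℕ} → (∀ i → 0 < f i) → k ≤ sumFin f
k≤sumFin-positive {zero}  f>0 = z≤n
k≤sumFin-positive {suc k} f>0 = +-mono-≤ (f>0 zero) (k≤sumFin-positive (f>0 ∘ suc))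

anyFin-intro : ∀ {k} (b : Fin k → Bool) i → b i ≡ true → anyFin b ≡ true
anyFin-intro b zero    bᵢ = cong (_∨ anyFin (b ∘ suc)) bᵢ
anyFin-intro b (suc i) bᵢ = trans (cong (b zero ∨_) (anyFin-intro (b ∘ suc) i bᵢ)) (∨-zeroʳ (b zero))

anyFin-elim : ∀ {k} (b : Fin k → Bool) → anyFin b ≡ true → ∃ λ i → b i ≡ true
anyFin-elim {suc k} b any with b zero in b₀
... | true  = zero , b₀
... | false with anyFin-elim (b ∘ suc) any
...   | i , bᵢ = suc i , bᵢ

PairwiseExclusive : ∀ {k} → (Fin k → Bool) → Set
PairwiseExclusive b = ∀ i j → i ≢ j → b i ≡ true → b j ≡ true → ⊥

sumFin-indicator-exclusive : ∀ {k} (b : Fin k → Bool) (t : Bool) → PairwiseExclusive b →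
                          sumFin (λ i → indicator (b i ∧ t)) ≤ indicator (anyFin b ∧ t)
sumFin-indicator-exclusive {zero}  b t excl = z≤n
sumFin-indicator-exclusive {suc k} b t excl with b zero in b₀
... | true  = ≤-reflexive (trans (cong (indicator t +_) (sumFin-zero others-vanish)) (+-identityʳ _))
  where
  others-vanish : ∀ i → indicator (b (suc i) ∧ t) ≡ 0
  others-vanish i = cong (λ x → indicator (x ∧ t)) (¬-not (excl zero (suc i) (λ ()) b₀))
... | false = sumFin-indicator-exclusive (b ∘ suc) t
                (λ i j i≢j → excl (suc i) (suc j) (i≢j ∘ suc-injective))

∣∩∣≡0⇒Disjoint : ∀ {n} (P Q : Array n) → ∣ P ∩ Q ∣ ≡ 0 → Disjoint P Q
∣∩∣≡0⇒Disjoint P Q ∣P∩Q∣≡0 r c s p q with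
  trans (sym (cong₂ (λ x y → indicator (x ∧ y)) p q))
        (sumFin≡0⇒≡0 (sumFin≡0⇒≡0 (sumFin≡0⇒≡0 ∣P∩Q∣≡0 r) c) s)
... | ()

∣∩∣-positive : ∀ {n} (P Q : Array n) → ¬ Disjoint P Q → 0 < ∣ P ∩ Q ∣
∣∩∣-positive P Q meet = n≢0⇒n>0 (meet ∘ ∣∩∣≡0⇒Disjoint P Q)

sumFin-∣∩∣≤∣⋃∩∣ : ∀ {n m} (C : Fin m → Array n) (T : Array n) →
                  (∀ i j → i ≢ j → Disjoint (C i) (C j)) →
                  sumFin (λ i → ∣ C i ∩ T ∣) ≤ ∣ ⋃ C ∩ T ∣
sumFin-∣∩∣≤∣⋃∩∣ C T disjoint = begin
  sumFin (λ i → ∣ C i ∩ T ∣)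
    ≡⟨ trans (sumFin-comm (λ i r → sumFin λ c → sumFin λ s → F i r c s))
             (sumFin-cong λ r → trans (sumFin-comm (λ i c → sumFin λ s → F i r c s))
                                      (sumFin-cong λ c → sumFin-comm (λ i s → F i r c s))) ⟩
  (sumFin λ r → sumFin λ c → sumFin λ s → sumFin λ i → F i r c s)
    ≤⟨ sumFin-mono-≤ (λ r → sumFin-mono-≤ λ c → sumFin-mono-≤ λ s →
         sumFin-indicator-exclusive (λ i → C i r c s) (T r c s) (λ i j i≢j → disjoint i j i≢j r c s)) ⟩
  ∣ ⋃ C ∩ T ∣ ∎
  where
  open ≤-Reasoning
  F : Fin _ → Fin _ → Fin _ → Fin _ → ℕ
  F i r c s = indicator (C i r c s ∧ T r c s)

⊆-⋃ : ∀ {n m} (C : Fin m → Array n) i → C i ⊆ ⋃ C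
⊆-⋃ C i r c s = anyFin-intro (λ j → C j r c s) i

⋃-⊆ : ∀ {n m} {C : Fin m → Array n} {P : Array n} → (∀ i → C i ⊆ P) → ⋃ C ⊆ P
⋃-⊆ {C = C} Cᵢ⊆P r c s p with anyFin-elim (λ i → C i r c s) p
... | i , q = Cᵢ⊆P i r c s q

isDefiningSet-⊇ : ∀ {n} {L D E : Array n} → IsDefiningSet L D → D ⊆ E → E ⊆ L → IsDefiningSet L E
isDefiningSet-⊇ D-def D⊆E E⊆L = record
  { sub    = E⊆L
  ; unique = λ L′ L′-latin E⊆L′ → IsDefiningSet.unique D-def L′ L′-latin (λ r c s → E⊆L′ r c s ∘ D⊆E r c s)
  }

_∪_ : ∀ {n} → Array n → Array n → Array n
(P ∪ Q) r c s = P r c s ∨ Q r c s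

_∖_ : ∀ {n} → Array n → Array n → Array n
(P ∖ Q) r c s = P r c s ∧ not (Q r c s)

∪-introˡ : ∀ {n} {P Q : Array n} {r c s} → P ∋⟨ r , c , s ⟩ → (P ∪ Q) ∋⟨ r , c , s ⟩
∪-introˡ {Q = Q} {r} {c} {s} p = cong (_∨ Q r c s) p

∪-introʳ : ∀ {n} {P Q : Array n} {r c s} → Q ∋⟨ r , c , s ⟩ → (P ∪ Q) ∋⟨ r , c , s ⟩
∪-introʳ {P = P} {r = r} {c} {s} q = trans (cong (P r c s ∨_) q) (∨-zeroʳ (P r c s))

∖-intro : ∀ {n} {P Q : Array n} {r c s} → P ∋⟨ r , c , s ⟩ → ¬ Q ∋⟨ r , c , s ⟩ → (P ∖ Q) ∋⟨ r , c , s ⟩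
∖-intro p ¬q = cong₂ _∧_ p (cong not (¬-not ¬q))

∖-elim : ∀ {n} {P Q : Array n} {r c s} → (P ∖ Q) ∋⟨ r , c , s ⟩ → P ∋⟨ r , c , s ⟩ × ¬ Q ∋⟨ r , c , s ⟩
∖-elim p∖q with ∧-true⁻ p∖q
... | p , not-q = p , not-true⁻ not-q

∖-⊆ : ∀ {n} {P Q : Array n} → (P ∖ Q) ⊆ P
∖-⊆ {P = P} {Q} r c s = proj₁ ∘ ∖-elim {P = P} {Q = Q}

record NoClash {n} (P Q : Array n) : Set where
  field
    cell : ∀ {r c s s′} → P ∋⟨ r , c , s ⟩ → ¬ Q ∋⟨ r , c , s′ ⟩
    row  : ∀ {r c c′ s} → P ∋⟨ r , c , s ⟩ → ¬ Q ∋⟨ r , c′ , s ⟩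
    col  : ∀ {r r′ c s} → P ∋⟨ r , c , s ⟩ → ¬ Q ∋⟨ r′ , c , s ⟩

⊆-isPLS : ∀ {n} {P Q : Array n} → Q ⊆ P → IsPLS P → IsPLS Q
⊆-isPLS Q⊆P P-pls = record
  { cell = λ r c s s′ p q → IsPLS.cell P-pls r c s s′ (Q⊆P _ _ _ p) (Q⊆P _ _ _ q)
  ; row  = λ r c c′ s p q → IsPLS.row  P-pls r c c′ s (Q⊆P _ _ _ p) (Q⊆P _ _ _ q)
  ; col  = λ r r′ c s p q → IsPLS.col  P-pls r r′ c s (Q⊆P _ _ _ p) (Q⊆P _ _ _ q)
  }

∪-isPLS : ∀ {n} {P Q : Array n} → IsPLS P → IsPLS Q → NoClash P Q → IsPLS (P ∪ Q)
∪-isPLS {P = P} {Q} P-pls Q-pls noClash = record { cell = cell ; row = row ; col = col }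
  where
  module P = IsPLS P-pls
  module Q = IsPLS Q-pls
  module N = NoClash noClash
  split : ∀ {r c s} → (P ∪ Q) ∋⟨ r , c , s ⟩ → P ∋⟨ r , c , s ⟩ ⊎ Q ∋⟨ r , c , s ⟩
  split {r} {c} {s} = ∨-true⁻ {P r c s}

  cell : ∀ r c s s′ → (P ∪ Q) ∋⟨ r , c , s ⟩ → (P ∪ Q) ∋⟨ r , c , s′ ⟩ → s ≡ s′
  cell r c s s′ x y with split x | split y
  ... | inj₁ p | inj₁ p′ = P.cell r c s s′ p p′
  ... | inj₂ q | inj₂ q′ = Q.cell r c s s′ q q′
  ... | inj₁ p | inj₂ q′ = ⊥-elim (N.cell p q′)
  ... | inj₂ q | inj₁ p′ = ⊥-elim (N.cell p′ q)

  row : ∀ r c c′ s → (P ∪ Q) ∋⟨ r , c , s ⟩ → (P ∪ Q) ∋⟨ r , c′ , s ⟩ → c ≡ c′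
  row r c c′ s x y with split x | split y
  ... | inj₁ p | inj₁ p′ = P.row r c c′ s p p′
  ... | inj₂ q | inj₂ q′ = Q.row r c c′ s q q′
  ... | inj₁ p | inj₂ q′ = ⊥-elim (N.row p q′)
  ... | inj₂ q | inj₁ p′ = ⊥-elim (N.row p′ q)

  col : ∀ r r′ c s → (P ∪ Q) ∋⟨ r , c , s ⟩ → (P ∪ Q) ∋⟨ r′ , c , s ⟩ → r ≡ r′
  col r r′ c s x y with split x | split y
  ... | inj₁ p | inj₁ p′ = P.col r r′ c s p p′
  ... | inj₂ q | inj₂ q′ = Q.col r r′ c s q q′
  ... | inj₁ p | inj₂ q′ = ⊥-elim (N.col p q′)
  ... | inj₂ q | inj₁ p′ = ⊥-elim (N.col p′ q)

module _ {n} {L T : Array n} (L-latin : IsLatinSquare L) (trade : IsLatinTrade L T) where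
  open IsLatinTrade trade
  private module L = IsPLS (IsLatinSquare.pls L-latin)

  traded : Array n
  traded = (L ∖ T) ∪ partner

  untouched⊆traded : ∀ {r c s} → L ∋⟨ r , c , s ⟩ → ¬ T ∋⟨ r , c , s ⟩ → traded ∋⟨ r , c , s ⟩
  untouched⊆traded l ¬t = ∪-introˡ {P = L ∖ T} {Q = partner} (∖-intro {P = L} {Q = T} l ¬t)

  partner⊆traded : partner ⊆ traded
  partner⊆traded _ _ _ = ∪-introʳ {P = L ∖ T} {Q = partner}

  -- A triple of T′ has a partner triple of T ⊆ L on the same line; L being
  -- Latin, that is the clashing triple of L ∖ T itself, which then lies in T.
  untouched-noClash-partner : NoClash (L ∖ T) partner
  untouched-noClash-partner = record { cell = cell ; row = row ; col = col }
    where
    cell : ∀ {r c s s′} → (L ∖ T) ∋⟨ r , c , s ⟩ → ¬ partner ∋⟨ r , c , s′ ⟩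
    cell {r} {c} x q with ∖-elim {P = L} {Q = T} x | Equivalence.from (sameCells r c) (_ , q)
    ... | l , ¬t | s″ , t = ¬t (subst (λ y → T ∋⟨ r , c , y ⟩) (L.cell r c _ _ (sub _ _ _ t) l) t)

    row : ∀ {r c c′ s} → (L ∖ T) ∋⟨ r , c , s ⟩ → ¬ partner ∋⟨ r , c′ , s ⟩
    row {r} {s = s} x q with ∖-elim {P = L} {Q = T} x | Equivalence.from (sameRowSyms r s) (_ , q)
    ... | l , ¬t | c″ , t = ¬t (subst (λ y → T ∋⟨ r , y , s ⟩) (L.row r _ _ s (sub _ _ _ t) l) t)

    col : ∀ {r r′ c s} → (L ∖ T) ∋⟨ r , c , s ⟩ → ¬ partner ∋⟨ r′ , c , s ⟩
    col {c = c} {s} x q with ∖-elim {P = L} {Q = T} x | Equivalence.from (sameColSyms c s) (_ , q)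
    ... | l , ¬t | r″ , t = ¬t (subst (λ y → T ∋⟨ y , c , s ⟩) (L.col _ _ c s (sub _ _ _ t) l) t)

  traded-isLatinSquare : IsLatinSquare traded
  traded-isLatinSquare = record
    { pls    = ∪-isPLS (⊆-isPLS (∖-⊆ {P = L} {Q = T}) (IsLatinSquare.pls L-latin)) partnerPLS
                       untouched-noClash-partner
    ; filled = filled
    }
    where
    filled : ∀ r c → ∃ λ s → traded ∋⟨ r , c , s ⟩
    filled r c with IsLatinSquare.filled L-latin r c
    ... | s , l with T r c s in t
    ...   | false = s , untouched⊆traded l (not-¬ t)
    ...   | true with Equivalence.to (sameCells r c) (s , t)
    ...     | s′ , q = s′ , partner⊆traded r c s′ q

  -- A defining set avoiding T lies in the traded square, which must then be L;
  -- but on a cell of T that square carries T′'s symbol, which differs from T's.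
  definingSet-meets-trade : ∀ {D} → IsDefiningSet L D → ¬ Disjoint D T
  definingSet-meets-trade {D} D-def D∩T=∅ with nonEmpty
  ... | r , c , s , t with Equivalence.to (sameCells r c) (s , t)
  ...   | s′ , q = disjoint r c s t (subst (λ y → partner ∋⟨ r , c , y ⟩) (sym s≡s′) q)
    where
    D⊆traded : D ⊆ traded
    D⊆traded r c s d = untouched⊆traded (IsDefiningSet.sub D-def r c s d) (D∩T=∅ r c s d)
    s≡s′ : s ≡ s′
    s≡s′ = L.cell r c s s′ (sub r c s t)
             (IsDefiningSet.unique D-def traded traded-isLatinSquare D⊆traded r c s′ (partner⊆traded r c s′ q))

lemma6 : (n m : ℕ) → 1 ≤ m → (L : Array n) → IsLatinSquare L →
         (C : Fin m → Array n) → (∀ i → IsDefiningSet L (C i)) →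
         (∀ i j → i ≢ j → Disjoint (C i) (C j)) →
         IsStrongDefiningSet m L (⋃ C)
lemma6 _ zero () _ _ _ _ _
lemma6 n (suc m) _ L L-latin C C-def C-disjoint = record { defining = ⋃C-def ; strong = strong }
  where
  ⋃C-def : IsDefiningSet L (⋃ C)
  ⋃C-def = isDefiningSet-⊇ (C-def zero) (⊆-⋃ C zero) (⋃-⊆ (IsDefiningSet.sub ∘ C-def))

  strong : (T : Array n) → IsLatinTrade L T → suc m ≤ ∣ ⋃ C ∩ T ∣
  strong T trade = begin
    suc m                       ≤⟨ k≤sumFin-positive (λ i → ∣∩∣-positive (C i) T
                                     (definingSet-meets-trade L-latin trade (C-def i))) ⟩
    sumFin (λ i → ∣ C i ∩ T ∣)  ≤⟨ sumFin-∣∩∣≤∣⋃∩∣ C T C-disjoint ⟩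
    ∣ ⋃ C ∩ T ∣                 ∎
    where open ≤-Reasoning
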